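{- Let $T$ be a set of $\mathsf{DFNL^*}$-formulas containing the two distinguished propositional letters $p_\bot$ and $p_\top$ and closed under subformulas. Then for every $A\in c(T)$, each of the sequents $p_\bot\Rightarrow A$, $A\circ p_\bot\Rightarrow p_\bot$, $p_\bot\circ A\Rightarrow p_\bot$, $A\Rightarrow p_\top$, $A\circ p_\top\Rightarrow p_\top$, $p_\top\circ A\Rightarrow p_\top$ is derivable from $\Theta[T]$ in $\mathsf{DFNL^*}$.
   Context: $\mathsf{DFNL^*}$: formulas $A::=p\mid A\wedge B\mid A\vee B\mid A\cdot B\mid A\backslash B\mid A/B$; formula trees $\Gamma::=A\mid\Gamma\circ\Delta$ ($\Gamma[\Delta]$: distinguished subtree occurrence); sequents $\Gamma\Rightarrow A$ with $\Gamma$ a tree or empty. Axioms: $A\Rightarrow A$; $A\wedge(B\vee C)\Rightarrow(A\wedge B)\vee(A\wedge C)$. Rules: from $\Delta\Rightarrow A$, $\Gamma[B]\Rightarrow C$ infer $\Gamma[\Delta\circ(A\backslash B)]\Rightarrow C$; from $A\circ\Gamma\Rightarrow B$ infer $\Gamma\Rightarrow A\backslash B$; from $\Gamma[A]\Rightarrow C$, $\Delta\Rightarrow B$ infer $\Gamma[(A/B)\circ\Delta]\Rightarrow C$; from $\Gamma\circ B\Rightarrow A$ infer $\Gamma\Rightarrow A/B$ ($\Gamma$ may be empty in these two); from $\Gamma[A\circ B]\Rightarrow C$ infer $\Gamma[A\cdot B]\Rightarrow C$; from $\Gamma\Rightarrow A$, $\Delta\Rightarrow B$ infer $\Gamma\circ\Delta\Rightarrow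 A\cdot B$; Cut: from $\Delta\Rightarrow A$, $\Gamma[A]\Rightarrow B$ infer $\Gamma[\Delta]\Rightarrow B$; from $\Gamma[A_i]\Rightarrow B$ infer $\Gamma[A_1\wedge A_2]\Rightarrow B$; from $\Gamma\Rightarrow A$, $\Gamma\Rightarrow B$ infer $\Gamma\Rightarrow A\wedge B$; from $\Gamma[A_1]\Rightarrow B$, $\Gamma[A_2]\Rightarrow B$ infer $\Gamma[A_1\vee A_2]\Rightarrow B$; from $\Gamma\Rightarrow A_i$ infer $\Gamma\Rightarrow A_1\vee A_2$. "Derivable from $\Phi$" means derivable using the sequents of $\Phi$ as extra axioms. $c(T)$ is the closure of $T$ under $\wedge,\vee$. $\Theta[T]$ is the set of all sequents $p_\bot\Rightarrow A$, $A\circ p_\bot\Rightarrow p_\bot$, $p_\bot\circ A\Rightarrow p_\bot$, $A\Rightarrow p_\top$, $A\circ p_\top\Rightarrow p_\top$, $p_\top\circ A\Rightarrow p_\top$ for $A\in T$. -}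

module Defs where

open import Data.Nat using (ℕ)
open import Data.Maybe using (Maybe; just; nothing)
open import Data.Product using (_×_; _,_)

data Formula : Set where
  var  : ℕ → Formula
  _∧_  : Formula → Formula → Formula
  _∨_  : Formula → Formula → Formula
  _·_  : Formula → Formula → Formula
  _⧵_  : Formula → Formula → Formula
  _⁄_  : Formula → Formula → Formula

p⊥ : Formula
p⊥ = var 0

p⊤ : Formula
p⊤ = var 1

data Tree : Set where
  leaf : Formula → Tree
  _∘_  : Tree → Tree → Tree

Ante : Set
Ante = Maybe Tree

_⊙_ : Ante → Ante → Ante
nothing ⊙ Δ       = Δ
just Γ  ⊙ nothing = just Γ
just Γ  ⊙ just Δ  = just (Γ ∘ Δ)

data Ctx : Set where
  hole : Ctx
  _◂_  : Ctx → Tree → Ctx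
  _▸_  : Tree → Ctx → Ctx

_[_] : Ctx → Ante → Ante
hole    [ Δ ] = Δ
(Γ ◂ T) [ Δ ] = (Γ [ Δ ]) ⊙ just T
(T ▸ Γ) [ Δ ] = just T ⊙ (Γ [ Δ ])

_⟦_⟧ : Ctx → Formula → Ante
Γ ⟦ A ⟧ = Γ [ just (leaf A) ]

record Sequent : Set where
  constructor _⇒_
  field
    ante : Ante
    succ : Formula

infix 4 _⇒_

data _⊢_ (Φ : Sequent → Set) : Sequent → Set where
  ax     : ∀ {s} → Φ s → Φ ⊢ s
  id     : ∀ {A} → Φ ⊢ (just (leaf A) ⇒ A)
  dist   : ∀ {A B C} → Φ ⊢ (just (leaf (A ∧ (B ∨ C))) ⇒ ((A ∧ B) ∨ (A ∧ C)))
  ⧵L     : ∀ {Γ Δ A B C} → Φ ⊢ (Δ ⇒ A) → Φ ⊢ (Γ ⟦ B ⟧ ⇒ C)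
           → Φ ⊢ (Γ [ Δ ⊙ just (leaf (A ⧵ B)) ] ⇒ C)
  ⧵R     : ∀ {Γ A B} → Φ ⊢ (just (leaf A) ⊙ Γ ⇒ B) → Φ ⊢ (Γ ⇒ (A ⧵ B))
  ⁄L     : ∀ {Γ Δ A B C} → Φ ⊢ (Γ ⟦ A ⟧ ⇒ C) → Φ ⊢ (Δ ⇒ B)
           → Φ ⊢ (Γ [ just (leaf (A ⁄ B)) ⊙ Δ ] ⇒ C)
  ⁄R     : ∀ {Γ A B} → Φ ⊢ (Γ ⊙ just (leaf B) ⇒ A) → Φ ⊢ (Γ ⇒ (A ⁄ B))
  ·L     : ∀ {Γ A B C} → Φ ⊢ (Γ [ just (leaf A ∘ leaf B) ] ⇒ C)
           → Φ ⊢ (Γ ⟦ A · B ⟧ ⇒ C)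
  ·R     : ∀ {Γ Δ A B} → Φ ⊢ (Γ ⇒ A) → Φ ⊢ (Δ ⇒ B) → Φ ⊢ (Γ ⊙ Δ ⇒ (A · B))
  cut    : ∀ {Γ Δ A B} → Φ ⊢ (Δ ⇒ A) → Φ ⊢ (Γ ⟦ A ⟧ ⇒ B) → Φ ⊢ (Γ [ Δ ] ⇒ B)
  ∧L₁    : ∀ {Γ A₁ A₂ B} → Φ ⊢ (Γ ⟦ A₁ ⟧ ⇒ B) → Φ ⊢ (Γ ⟦ A₁ ∧ A₂ ⟧ ⇒ B)
  ∧L₂    : ∀ {Γ A₁ A₂ B} → Φ ⊢ (Γ ⟦ A₂ ⟧ ⇒ B) → Φ ⊢ (Γ ⟦ A₁ ∧ A₂ ⟧ ⇒ B)
  ∧R     : ∀ {Γ A B} → Φ ⊢ (Γ ⇒ A) → Φ ⊢ (Γ ⇒ B) → Φ ⊢ (Γ ⇒ (A ∧ B))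
  ∨L     : ∀ {Γ A₁ A₂ B} → Φ ⊢ (Γ ⟦ A₁ ⟧ ⇒ B) → Φ ⊢ (Γ ⟦ A₂ ⟧ ⇒ B)
           → Φ ⊢ (Γ ⟦ A₁ ∨ A₂ ⟧ ⇒ B)
  ∨R₁    : ∀ {Γ A₁ A₂} → Φ ⊢ (Γ ⇒ A₁) → Φ ⊢ (Γ ⇒ (A₁ ∨ A₂))
  ∨R₂    : ∀ {Γ A₁ A₂} → Φ ⊢ (Γ ⇒ A₂) → Φ ⊢ (Γ ⇒ (A₁ ∨ A₂))

FSet : Set₁
FSet = Formula → Set

SubClosed : FSet → Set
SubClosed T = ∀ {A B}
  → (T (A ∧ B) → T A × T B)
  × (T (A ∨ B) → T A × T B)
  × (T (A · B) → T A × T B)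
  × (T (A ⧵ B) → T A × T B)
  × (T (A ⁄ B) → T A × T B)

data c (T : FSet) : FSet where
  base : ∀ {A} → T A → c T A
  and  : ∀ {A B} → c T A → c T B → c T (A ∧ B)
  or   : ∀ {A B} → c T A → c T B → c T (A ∨ B)

data Θ (T : FSet) : Sequent → Set where
  θ₁ : ∀ {A} → T A → Θ T (just (leaf p⊥) ⇒ A)
  θ₂ : ∀ {A} → T A → Θ T (just (leaf A ∘ leaf p⊥) ⇒ p⊥)
  θ₃ : ∀ {A} → T A → Θ T (just (leaf p⊥ ∘ leaf A) ⇒ p⊥)
  θ₄ : ∀ {A} → T A → Θ T (just (leaf A) ⇒ p⊤)
  θ₅ : ∀ {A} → T A → Θ T (just (leaf A ∘ leaf p⊤) ⇒ p⊤)
  θ₆ : ∀ {A} → T A → Θ T (just (leaf p⊤ ∘ leaf A) ⇒ p⊤)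

-- The six sequents say that p⊥ and p⊤ behave as bottom and top (and as
-- multiplicative zeros) relative to A. They are axioms of Θ[T] for A ∈ T, and
-- they are preserved by ∧ and ∨: for A ∧ B the left sequents need only the
-- conjunct A (∧L) and p⊥ ⇒ A ∧ B uses ∧R; dually for A ∨ B.
module Submission where

open import Defs
open import Data.Maybe using (just)
open import Data.Product using (_×_; _,_)

Bounded : (Sequent → Set) → Formula → Set
Bounded Φ A =
  (Φ ⊢ (just (leaf p⊥) ⇒ A))
  × (Φ ⊢ (just (leaf A ∘ leaf p⊥) ⇒ p⊥))
  × (Φ ⊢ (just (leaf p⊥ ∘ leaf A) ⇒ p⊥))
  × (Φ ⊢ (just (leaf A) ⇒ p⊤))
  × (Φ ⊢ (just (leaf A ∘ leaf p⊤) ⇒ p⊤))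
  × (Φ ⊢ (just (leaf p⊤ ∘ leaf A) ⇒ p⊤))

module _ {Φ : Sequent → Set} {A B : Formula} where

  ∧-bounded : Bounded Φ A → Bounded Φ B → Bounded Φ (A ∧ B)
  ∧-bounded (a₁ , a₂ , a₃ , a₄ , a₅ , a₆) (b₁ , _) =
    ∧R a₁ b₁ ,
    ∧L₁ {Γ = hole ◂ leaf p⊥} a₂ ,
    ∧L₁ {Γ = leaf p⊥ ▸ hole} a₃ ,
    ∧L₁ {Γ = hole} a₄ ,
    ∧L₁ {Γ = hole ◂ leaf p⊤} a₅ ,
    ∧L₁ {Γ = leaf p⊤ ▸ hole} a₆

  ∨-bounded : Bounded Φ A → Bounded Φ B → Bounded Φ (A ∨ B)
  ∨-bounded (a₁ , a₂ , a₃ , a₄ , a₅ , a₆) (_ , b₂ , b₃ , b₄ , b₅ , b₆) =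
    ∨R₁ a₁ ,
    ∨L {Γ = hole ◂ leaf p⊥} a₂ b₂ ,
    ∨L {Γ = leaf p⊥ ▸ hole} a₃ b₃ ,
    ∨L {Γ = hole} a₄ b₄ ,
    ∨L {Γ = hole ◂ leaf p⊤} a₅ b₅ ,
    ∨L {Γ = leaf p⊤ ▸ hole} a₆ b₆

Θ-bounded : ∀ {T A} → T A → Bounded (Θ T) A
Θ-bounded t = ax (θ₁ t) , ax (θ₂ t) , ax (θ₃ t) , ax (θ₄ t) , ax (θ₅ t) , ax (θ₆ t)

c-bounded : ∀ {T A} → c T A → Bounded (Θ T) A
c-bounded (base t)   = Θ-bounded t
c-bounded (and a b)  = ∧-bounded (c-bounded a) (c-bounded b)
c-bounded (or a b)   = ∨-bounded (c-bounded a) (c-bounded b)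

lemma7 : (T : FSet) → T p⊥ → T p⊤ → SubClosed T
    → ∀ A → c T A
    → (Θ T ⊢ (just (leaf p⊥) ⇒ A))
      × (Θ T ⊢ (just (leaf A ∘ leaf p⊥) ⇒ p⊥))
      × (Θ T ⊢ (just (leaf p⊥ ∘ leaf A) ⇒ p⊥))
      × (Θ T ⊢ (just (leaf A) ⇒ p⊤))
      × (Θ T ⊢ (just (leaf A ∘ leaf p⊤) ⇒ p⊤))
      × (Θ T ⊢ (just (leaf p⊤ ∘ leaf A) ⇒ p⊤))
lemma7 T _ _ _ A cA = c-bounded cA
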